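{- Let $G=(V,E)$ be a claw-free graph with clique number $\omega(G)\ge 4$. For any $v\in V$ with $\deg(v)\ge 2\omega(G)-1$, \[ |N(N(v))\setminus\{v\}| \le \frac{\deg(v)(\omega(G)-1)}{\lceil(\deg(v)+1)/2\rceil+2-\omega(G)}. \]
   Context: A graph is claw-free if it has no induced $K_{1,3}$. $N(u)$ is the open neighbourhood of a vertex $u$; for a set $S$ of vertices, $N(S)=\bigcup_{s\in S}N(s)\setminus S$. -}

module Defs where

open import Data.Nat using (ℕ)
open import Data.Bool using (Bool; true; false; if_then_else_)
open import Data.Fin using (Fin)
open import Data.Fin.Subset using (Subset; ⊥; _∈_; _─_; ⋃; ∣_∣; _-_)
open import Data.Vec using (tabulate; lookup)
open import Data.List using (map; allFin)
open import Data.Product using (Σ; ∃; _×_; _,_)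
open import Relation.Binary.PropositionalEquality using (_≡_; _≢_)
open import Relation.Nullary using (¬_)

record Graph (n : ℕ) : Set where
  field
    adj   : Fin n → Fin n → Bool
    sym   : ∀ u v → adj u v ≡ adj v u
    irrefl : ∀ v → adj v v ≡ false
open Graph public

module _ {n : ℕ} (G : Graph n) where

  N : Fin n → Subset n
  N u = tabulate (λ x → adj G u x)

  deg : Fin n → ℕ
  deg u = ∣ N u ∣

  NSet : Subset n → Subset n
  NSet S = ⋃ (map (λ s → if lookup S s then N s else ⊥) (allFin n)) ─ S

  IsClique : Subset n → Set
  IsClique S = ∀ x y → x ∈ S → y ∈ S → x ≢ y → adj G x y ≡ true

  CliqueNumber : ℕ → Set
  CliqueNumber w = (Σ (Subset n) λ S → IsClique S × ∣ S ∣ ≡ w)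
                 × (∀ S → IsClique S → ∣ S ∣ Data.Nat.≤ w)

  IsClaw : Fin n → Fin n → Fin n → Fin n → Set
  IsClaw c a b d =
    (adj G c a ≡ true) × (adj G c b ≡ true) × (adj G c d ≡ true) ×
    (a ≢ b) × (a ≢ d) × (b ≢ d) ×
    (adj G a b ≡ false) × (adj G a d ≡ false) × (adj G b d ≡ false)

  ClawFree : Set
  ClawFree = ∀ c a b d → ¬ IsClaw c a b d

-- Double count the edges between N(v) and T = N(N(v)) ∖ {v}.  The neighbours in T of a
-- vertex u ∈ N(v) are pairwise adjacent, since a non-edge among them would form a claw at u
-- with v; with u they form a clique, so there are at most ω − 1 of them.  Conversely, let
-- x ∈ T be reached through u₀ ∈ N(v).  The vertices of N(v) ∖ N(x) adjacent to u₀ form a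
-- clique together with u₀ and v, the remaining ones a clique together with v (claws at u₀
-- and at v otherwise), so x has at least deg v + 3 − 2ω neighbours in N(v), which is at
-- least ⌈(deg v + 1)/2⌉ + 2 − ω once 2ω ≤ deg v + 1.
module Submission where

open import Defs renaming (sym to adj-sym)
open import Data.Bool.Base using (Bool; true; false; _∧_; _∨_; not)
open import Data.Bool.Properties using (∧-conicalˡ; ∧-conicalʳ; ∧-zeroʳ)
open import Data.Fin.Base using (Fin; zero; suc)
open import Data.Fin.Properties using (_≟_)
open import Data.Fin.Subset using (Subset; _∈_; _∉_; _─_; _-_; ⋃; ⁅_⁆; ∣_∣; inside; outside)
open import Data.Fin.Subset.Properties using (∉⊥; x∈⁅x⁆; x∈p∪q⁻; drop-there)
open import Data.List.Base using (List; []; _∷_; map; allFin)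
open import Data.Nat.Base using (ℕ; zero; suc; _+_; _*_; _∸_; _≤_; z≤n; ⌈_/2⌉; ⌊_/2⌋)
open import Data.Nat.Properties hiding (_≟_)
open import Data.Nat.Tactic.RingSolver using (solve-∀)
open import Data.Product.Base using (∃-syntax; _×_; _,_; proj₁; proj₂)
import Data.Product.Base as Product
open import Data.Sum.Base using ([_,_]′)
open import Data.Vec.Base using ([]; _∷_; here; there; lookup; tabulate)
open import Data.Vec.Properties using (lookup∘tabulate; []=⇒lookup; lookup⇒[]=)
open import Function.Base using (_∘_)
open import Relation.Binary.PropositionalEquality
open import Relation.Nullary.Decidable.Core using (does; yes; no)
open import Relation.Nullary.Negation using (contradiction)
open import Algebra.Properties.Semiring.Sum +-*-semiring
  using (sum; sum-syntax; sum-cong-≗; ∑-distrib-+; ∑-comm; *-distribʳ-sum)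

private
  variable
    m n k : ℕ

indicator : Bool → ℕ
indicator true  = 1
indicator false = 0

count : (Fin n → Bool) → ℕ
count {n} f = ∑[ i < n ] indicator (f i)

sum-mono-≤ : {f g : Fin n → ℕ} → (∀ i → f i ≤ g i) → sum f ≤ sum g
sum-mono-≤ {zero}  _   = z≤n
sum-mono-≤ {suc n} f≤g = +-mono-≤ (f≤g zero) (sum-mono-≤ (f≤g ∘ suc))

count-cong : {f g : Fin n → Bool} → (∀ i → f i ≡ g i) → count f ≡ count g
count-cong f≗g = sum-cong-≗ (cong indicator ∘ f≗g)

count-none : {f : Fin n → Bool} → (∀ i → f i ≡ false) → count f ≡ 0
count-none {zero}  _     = refl
count-none {suc n} none rewrite none zero = count-none (none ∘ suc)

count-∧-∧not : (f g : Fin n → Bool) →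
  count f ≡ count (λ i → f i ∧ g i) + count (λ i → f i ∧ not (g i))
count-∧-∧not f g = trans (sum-cong-≗ (λ i → split (f i) (g i))) (∑-distrib-+ (λ i → indicator (f i ∧ g i)) _)
  where
  split : ∀ a b → indicator a ≡ indicator (a ∧ b) + indicator (a ∧ not b)
  split false _     = refl
  split true  true  = refl
  split true  false = refl

insert : Fin n → (Fin n → Bool) → Fin n → Bool
insert c f i = does (i ≟ c) ∨ f i

count-insert : (c : Fin n) (f : Fin n → Bool) → f c ≡ false → count (insert c f) ≡ suc (count f)
count-insert zero    f fc rewrite fc = refl
count-insert (suc c) f fc =
  trans (cong (indicator (f zero) +_) (count-insert c (f ∘ suc) fc)) (+-suc _ _)

∣p∣≡count : (p : Subset n) → ∣ p ∣ ≡ count (lookup p)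
∣p∣≡count []          = refl
∣p∣≡count (true ∷ p)  = cong suc (∣p∣≡count p)
∣p∣≡count (false ∷ p) = ∣p∣≡count p

∣tabulate∣≡count : (f : Fin n → Bool) → ∣ tabulate f ∣ ≡ count f
∣tabulate∣≡count f = trans (∣p∣≡count (tabulate f)) (count-cong (lookup∘tabulate f))

double-count : (R : Fin m → Fin k → Bool) (f : Fin m → Bool) (g : Fin k → Bool) {a b : ℕ} →
  (∀ x → f x ≡ true → a ≤ count (R x)) →
  (∀ u → g u ≡ true → count (λ x → f x ∧ R x u) ≤ b) →
  (∀ x u → R x u ≡ true → g u ≡ true) →
  count f * a ≤ count g * b
double-count {m} {k} R f g {a} {b} lower upper R⇒g = begin
    count f * a
  ≡⟨ *-distribʳ-sum a (indicator ∘ f) ⟩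
    ∑[ x < m ] (indicator (f x) * a)
  ≤⟨ sum-mono-≤ at-x ⟩
    ∑[ x < m ] ∑[ u < k ] indicator (f x ∧ R x u)
  ≡⟨ ∑-comm (λ x u → indicator (f x ∧ R x u)) ⟩
    ∑[ u < k ] ∑[ x < m ] indicator (f x ∧ R x u)
  ≤⟨ sum-mono-≤ at-u ⟩
    ∑[ u < k ] (indicator (g u) * b)
  ≡⟨ *-distribʳ-sum b (indicator ∘ g) ⟨
    count g * b ∎
  where
  open ≤-Reasoning
  at-x : ∀ x → indicator (f x) * a ≤ count (λ u → f x ∧ R x u)
  at-x x with f x in fx
  ... | false = z≤n
  ... | true  = ≤-trans (≤-reflexive (+-identityʳ a)) (lower x fx)
  at-u : ∀ u → count (λ x → f x ∧ R x u) ≤ indicator (g u) * b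
  at-u u with g u in gu
  ... | true  = ≤-trans (upper u gu) (≤-reflexive (sym (+-identityʳ b)))
  ... | false = ≤-reflexive (count-none no-pair)
    where
    no-pair : ∀ x → f x ∧ R x u ≡ false
    no-pair x with R x u in r
    ... | false = ∧-zeroʳ (f x)
    ... | true  with () ← trans (sym (R⇒g x u r)) gu

⌈n/2⌉+m≤n : ∀ {m} n → m + m ≤ n → ⌈ n /2⌉ + m ≤ n
⌈n/2⌉+m≤n {m} n m+m≤n = begin
    ⌈ n /2⌉ + m
  ≤⟨ +-monoʳ-≤ ⌈ n /2⌉ (≤-trans (≤-reflexive (n≡⌊n+n/2⌋ m)) (⌊n/2⌋-mono m+m≤n)) ⟩
    ⌈ n /2⌉ + ⌊ n /2⌋
  ≡⟨ +-comm ⌈ n /2⌉ ⌊ n /2⌋ ⟩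
    ⌊ n /2⌋ + ⌈ n /2⌉
  ≡⟨ ⌊n/2⌋+⌈n/2⌉≡n n ⟩
    n ∎
  where open ≤-Reasoning

ceiling-bound : ∀ {w d a} → 2 * w ∸ 1 ≤ d → d + 3 ≤ a + 2 * w → ⌈ suc d /2⌉ + 2 ∸ w ≤ a
ceiling-bound {w} {d} {a} 2w-1≤d d+3≤a+2w =
  m≤n+o⇒m∸n≤o (h + 2) w (+-cancelʳ-≤ w (h + 2) (w + a) (begin
      h + 2 + w
    ≡⟨ reorder h w ⟩
      (h + w) + 2
    ≤⟨ +-monoˡ-≤ 2 (⌈n/2⌉+m≤n (suc d) w+w≤1+d) ⟩
      suc d + 2
    ≡⟨ +-suc d 2 ⟨
      d + 3
    ≤⟨ d+3≤a+2w ⟩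
      a + 2 * w
    ≡⟨ regroup a w ⟩
      w + a + w ∎))
  where
  open ≤-Reasoning
  h = ⌈ suc d /2⌉
  reorder : ∀ h w → h + 2 + w ≡ (h + w) + 2
  reorder = solve-∀
  regroup : ∀ a w → a + 2 * w ≡ w + a + w
  regroup = solve-∀
  w+w≤1+d : w + w ≤ suc d
  w+w≤1+d = ≤-trans (≤-reflexive (cong (w +_) (sym (+-identityʳ w))))
                    (≤-trans (m≤n+m∸n (2 * w) 1) (+-monoʳ-≤ 1 2w-1≤d))

x∈p─q⁻ : (p q : Subset n) {x : Fin n} → x ∈ p ─ q → x ∈ p × x ∉ q
x∈p─q⁻ (inside  ∷ p) (outside ∷ q) here         = here , λ ()
x∈p─q⁻ (inside  ∷ p) (inside  ∷ q) {zero} ()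
x∈p─q⁻ (outside ∷ p) (inside  ∷ q) {zero} ()
x∈p─q⁻ (outside ∷ p) (outside ∷ q) {zero} ()
x∈p─q⁻ (_       ∷ p) (_       ∷ q) (there x∈p─q) =
  Product.map there (λ x∉q → x∉q ∘ drop-there) (x∈p─q⁻ p q x∈p─q)

x∈⋃⁻ : {A : Set} (F : A → Subset n) (as : List A) {x : Fin n} →
  x ∈ ⋃ (map F as) → ∃[ a ] x ∈ F a
x∈⋃⁻ F []       x∈⊥ = contradiction x∈⊥ ∉⊥
x∈⋃⁻ F (a ∷ as) x∈  = [ (a ,_) , x∈⋃⁻ F as ]′ (x∈p∪q⁻ (F a) _ x∈)

∈tabulate⁻ : (f : Fin n → Bool) {x : Fin n} → x ∈ tabulate f → f x ≡ true
∈tabulate⁻ f {x} x∈ = trans (sym (lookup∘tabulate f x)) ([]=⇒lookup x∈)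

∉tabulate⁻ : (f : Fin n → Bool) {x : Fin n} → x ∉ tabulate f → f x ≡ false
∉tabulate⁻ f {x} x∉ with f x in fx
... | false = refl
... | true  = contradiction (lookup⇒[]= x (tabulate f) (trans (lookup∘tabulate f x) fx)) x∉

not≡true⇒≡false : ∀ {b} → not b ≡ true → b ≡ false
not≡true⇒≡false {false} _ = refl

module _ (G : Graph n) where

  IsCliqueᵇ : (Fin n → Bool) → Set
  IsCliqueᵇ f = ∀ x y → f x ≡ true → f y ≡ true → x ≢ y → adj G x y ≡ true

  AdjacentToAll : Fin n → (Fin n → Bool) → Set
  AdjacentToAll c f = ∀ x → f x ≡ true → adj G c x ≡ true

  insert-isClique : ∀ {c f} → IsCliqueᵇ f → AdjacentToAll c f → IsCliqueᵇ (insert c f)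
  insert-isClique {c} clique c∼f x y fx fy x≢y with x ≟ c | y ≟ c
  ... | yes refl | yes refl = contradiction refl x≢y
  ... | yes refl | no _     = c∼f y fy
  ... | no _     | yes refl = trans (adj-sym G x y) (c∼f x fx)
  ... | no _     | no _     = clique x y fx fy x≢y

  count-insert-neighbour : ∀ c f → AdjacentToAll c f → count (insert c f) ≡ suc (count f)
  count-insert-neighbour c f c∼f = count-insert c f fc
    where
    fc : f c ≡ false
    fc with f c in eq
    ... | false = refl
    ... | true  with () ← trans (sym (irrefl G c)) (c∼f c eq)

  count≤ω : ∀ {w f} → CliqueNumber G w → IsCliqueᵇ f → count f ≤ w
  count≤ω {w} {f} (_ , maximal) clique =
    subst (_≤ w) (∣tabulate∣≡count f) (maximal (tabulate f) isClique)
    where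
    isClique : IsClique G (tabulate f)
    isClique x y x∈ y∈ = clique x y (∈tabulate⁻ f x∈) (∈tabulate⁻ f y∈)

  suc-count≤ω : ∀ {w c f} → CliqueNumber G w → IsCliqueᵇ f → AdjacentToAll c f → suc (count f) ≤ w
  suc-count≤ω {w} {c} {f} ω clique c∼f =
    subst (_≤ w) (count-insert-neighbour c f c∼f) (count≤ω ω (insert-isClique clique c∼f))

  nonNeighbours-isClique : ClawFree G → ∀ {c a f} → adj G c a ≡ true →
    (∀ x → f x ≡ true → adj G c x ≡ true × adj G a x ≡ false × a ≢ x) → IsCliqueᵇ f
  nonNeighbours-isClique clawFree {c} {a} c∼a members x y fx fy x≢y with adj G x y in x∼y
  ... | true  = refl
  ... | false = contradiction (c∼a , c∼x , c∼y , a≢x , a≢y , x≢y , a≁x , a≁y , x∼y) (clawFree c a x y)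
    where
    c∼x = proj₁ (members x fx)
    c∼y = proj₁ (members y fy)
    a≁x = proj₁ (proj₂ (members x fx))
    a≁y = proj₁ (proj₂ (members y fy))
    a≢x = proj₂ (proj₂ (members x fx))
    a≢y = proj₂ (proj₂ (members y fy))

  record SecondNeighbour (v x : Fin n) : Set where
    field
      distinct    : x ≢ v
      nonadjacent : adj G v x ≡ false
      via         : Fin n
      v∼via       : adj G v via ≡ true
      via∼x       : adj G via x ≡ true

  ∈N²⁻ : ∀ {v x} → x ∈ NSet G (N G v) - v → SecondNeighbour v x
  ∈N²⁻ {v} {x} x∈ with x∈p─q⁻ _ ⁅ v ⁆ x∈
  ... | x∈N[Nv] , x∉⁅v⁆ with x∈p─q⁻ _ (N G v) x∈N[Nv]
  ... | x∈⋃ , x∉Nv with x∈⋃⁻ _ (allFin n) x∈⋃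
  ... | u , x∈Fu with lookup (N G v) u in u∈Nv
  ... | true = record
    { distinct    = λ { refl → x∉⁅v⁆ (x∈⁅x⁆ x) }
    ; nonadjacent = ∉tabulate⁻ (adj G v) x∉Nv
    ; via         = u
    ; v∼via       = trans (sym (lookup∘tabulate (adj G v) u)) u∈Nv
    ; via∼x       = ∈tabulate⁻ (adj G u) x∈Fu
    }
  ... | false = contradiction x∈Fu ∉⊥

  secondNeighbourhood : Fin n → Fin n → Bool
  secondNeighbourhood v = lookup (NSet G (N G v) - v)

  secondNeighbour⁻ : ∀ {v x} → secondNeighbourhood v x ≡ true → SecondNeighbour v x
  secondNeighbour⁻ {v} {x} x∈ = ∈N²⁻ (lookup⇒[]= x (NSet G (N G v) - v) x∈)

  commonNeighbours : Fin n → Fin n → Fin n → Bool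
  commonNeighbours v x u = adj G v u ∧ adj G u x

  count-secondNeighbours-of-neighbour : ClawFree G → ∀ {w v u} → CliqueNumber G w → adj G v u ≡ true →
    count (λ x → secondNeighbourhood v x ∧ adj G u x) ≤ w ∸ 1
  count-secondNeighbours-of-neighbour clawFree {w} {v} {u} ω v∼u =
    suc[m]≤n⇒m≤pred[n] (suc-count≤ω ω clique u∼f)
    where
    f : Fin n → Bool
    f x = secondNeighbourhood v x ∧ adj G u x
    u∼f : AdjacentToAll u f
    u∼f x fx = ∧-conicalʳ _ _ fx
    clique : IsCliqueᵇ f
    clique = nonNeighbours-isClique clawFree {f = f} (trans (adj-sym G u v) v∼u) λ x fx →
      let open SecondNeighbour (secondNeighbour⁻ (∧-conicalˡ _ _ fx))
      in u∼f x fx , nonadjacent , λ { refl → distinct refl }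

  deg+3≤commonNeighbours+2ω : ClawFree G → ∀ {w v x} → CliqueNumber G w → SecondNeighbour v x →
    deg G v + 3 ≤ count (commonNeighbours v x) + 2 * w
  deg+3≤commonNeighbours+2ω clawFree {w} {v} {x} ω x∈N² = begin
      deg G v + 3
    ≡⟨ cong (_+ 3) deg-split ⟩
      a + (count D + count C) + 3
    ≡⟨ regroup a (count D) (count C) ⟩
      a + (suc (suc (count D)) + suc (count C))
    ≤⟨ +-monoʳ-≤ a (+-mono-≤ D-bound C-bound) ⟩
      a + (w + w)
    ≡⟨ cong (λ t → a + (w + t)) (+-identityʳ w) ⟨
      a + 2 * w ∎
    where
    open ≤-Reasoning
    open SecondNeighbour x∈N² renaming (via to u₀)
    a = count (commonNeighbours v x)
    B = λ u → adj G v u ∧ not (adj G u x)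
    D = λ u → B u ∧ adj G u₀ u
    C = λ u → B u ∧ not (adj G u₀ u)

    regroup : ∀ a d c → a + (d + c) + 3 ≡ a + (suc (suc d) + suc c)
    regroup = solve-∀

    deg-split : deg G v ≡ a + (count D + count C)
    deg-split = begin-equality
        deg G v
      ≡⟨ ∣tabulate∣≡count (adj G v) ⟩
        count (adj G v)
      ≡⟨ count-∧-∧not (adj G v) (λ u → adj G u x) ⟩
        a + count B
      ≡⟨ cong (a +_) (count-∧-∧not B (adj G u₀)) ⟩
        a + (count D + count C) ∎

    v∼B : AdjacentToAll v B
    v∼B u Bu = ∧-conicalˡ _ _ Bu
    x≁B : ∀ u → B u ≡ true → adj G x u ≡ false
    x≁B u Bu = trans (adj-sym G x u) (not≡true⇒≡false (∧-conicalʳ _ _ Bu))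

    u₀∼D : AdjacentToAll u₀ D
    u₀∼D u Du = ∧-conicalʳ _ _ Du
    D-clique : IsCliqueᵇ D
    D-clique = nonNeighbours-isClique clawFree {f = D} via∼x λ u Du →
      let Bu = ∧-conicalˡ _ _ Du
      in u₀∼D u Du , x≁B u Bu , λ { refl → contradiction (trans (sym nonadjacent) (v∼B u Bu)) λ () }
    v∼u₀+D : AdjacentToAll v (insert u₀ D)
    v∼u₀+D u u∈ with u ≟ u₀
    ... | yes refl = v∼via
    ... | no _     = v∼B u (∧-conicalˡ _ _ u∈)
    D-bound : suc (suc (count D)) ≤ w
    D-bound = subst (λ k → suc k ≤ w) (count-insert-neighbour u₀ D u₀∼D)
                (suc-count≤ω ω (insert-isClique D-clique u₀∼D) v∼u₀+D)

    C-clique : IsCliqueᵇ C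
    C-clique = nonNeighbours-isClique clawFree {f = C} v∼via λ u Cu →
      let Bu = ∧-conicalˡ _ _ Cu
      in v∼B u Bu , not≡true⇒≡false (∧-conicalʳ _ _ Cu) ,
         λ { refl → contradiction (trans (sym (trans (adj-sym G x u₀) via∼x)) (x≁B u Bu)) λ () }
    C-bound : suc (count C) ≤ w
    C-bound = suc-count≤ω ω C-clique (λ u Cu → v∼B u (∧-conicalˡ _ _ Cu))

corollary6p2 : ∀ {n : ℕ} (G : Graph n) (w : ℕ) → ClawFree G → CliqueNumber G w → 4 ≤ w →
    ∀ (v : Fin n) → 2 * w ∸ 1 ≤ deg G v →
    ∣ NSet G (N G v) - v ∣ * (⌈ suc (deg G v) /2⌉ + 2 ∸ w) ≤ deg G v * (w ∸ 1)
corollary6p2 G w clawFree ω _ v 2w-1≤deg = begin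
    ∣ NSet G (N G v) - v ∣ * K
  ≡⟨ cong (_* K) (∣p∣≡count (NSet G (N G v) - v)) ⟩
    count (secondNeighbourhood G v) * K
  ≤⟨ double-count (commonNeighbours G v) (secondNeighbourhood G v) (adj G v)
       lower upper (λ x u → ∧-conicalˡ _ _) ⟩
    count (adj G v) * (w ∸ 1)
  ≡⟨ cong (_* (w ∸ 1)) (∣tabulate∣≡count (adj G v)) ⟨
    deg G v * (w ∸ 1) ∎
  where
  open ≤-Reasoning
  K = ⌈ suc (deg G v) /2⌉ + 2 ∸ w
  lower : ∀ x → secondNeighbourhood G v x ≡ true → K ≤ count (commonNeighbours G v x)
  lower x x∈ = ceiling-bound {w} 2w-1≤deg
    (deg+3≤commonNeighbours+2ω G clawFree ω (secondNeighbour⁻ G x∈))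
  upper : ∀ u → adj G v u ≡ true →
    count (λ x → secondNeighbourhood G v x ∧ commonNeighbours G v x u) ≤ w ∸ 1
  upper u v∼u rewrite v∼u = count-secondNeighbours-of-neighbour G clawFree ω v∼u
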